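{- Let $G$ be a graph with no isolated vertices. If $S\subseteq V(G)$ is a DIr-set, then $S$ is a VCIr-set. Consequently $\operatorname{DIR}(G)\le \operatorname{VCIR}(G)$.
   Context: Graphs are finite, simple, undirected; $N[v]$ denotes the closed neighborhood. A set $S\subseteq V(G)$ is a DIr-set (domination irredundant set) if for every $x\in S$ there is a vertex $w\in V(G)$ with $N[w]\cap S=\{x\}$. For $S\subseteq V(G)$ and $u\in S$, an edge $e$ is a private edge of $u$ if $S\cap e=\{u\}$; $S$ is a VCIr-set if every element of $S$ has a private edge. $\operatorname{DIR}(G)$ (resp. $\operatorname{VCIR}(G)$) is the maximum cardinality of a DIr-set (resp. VCIr-set) of $G$. -}

module Defs where

open import Data.Nat using (ℕ; _≤_)
open import Data.Fin using (Fin)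
open import Data.Fin.Subset using (Subset; _∈_; _∉_; ∣_∣)
open import Data.Product using (Σ; _×_; ∃-syntax)
open import Data.Sum using (_⊎_)
open import Relation.Nullary using (¬_)
open import Relation.Binary.PropositionalEquality using (_≡_)

record Graph : Set₁ where
  field
    n     : ℕ
    Adj   : Fin n → Fin n → Set
    sym   : ∀ {u v} → Adj u v → Adj v u
    irrefl : ∀ {u} → ¬ Adj u u

open Graph public

Vertex : Graph → Set
Vertex G = Fin (n G)

InClosedNbhd : (G : Graph) → Vertex G → Vertex G → Set
InClosedNbhd G v w = (v ≡ w) ⊎ Adj G w v

NoIsolatedVertices : Graph → Set
NoIsolatedVertices G = ∀ (v : Vertex G) → ∃[ u ] Adj G v u

IsDIrSet : (G : Graph) → Subset (n G) → Set
IsDIrSet G S = ∀ x → x ∈ S →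
  ∃[ w ] (InClosedNbhd G x w ×
          (∀ y → y ∈ S → InClosedNbhd G y w → y ≡ x))

IsPrivateEdge : (G : Graph) → Subset (n G) → (u v : Vertex G) → Set
IsPrivateEdge G S u v = Adj G u v × u ∈ S × v ∉ S

IsVCIrSet : (G : Graph) → Subset (n G) → Set
IsVCIrSet G S = ∀ u → u ∈ S → ∃[ v ] IsPrivateEdge G S u v

IsMaxCard : (m : ℕ) → (Subset m → Set) → ℕ → Set
IsMaxCard m P k = (∃[ S ] (P S × ∣ S ∣ ≡ k)) × (∀ S → P S → ∣ S ∣ ≤ k)

IsDIR : Graph → ℕ → Set
IsDIR G = IsMaxCard (n G) (IsDIrSet G)

IsVCIR : Graph → ℕ → Set
IsVCIR G = IsMaxCard (n G) (IsVCIrSet G)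

-- A private neighbour w of x ∈ S (N[w] ∩ S = {x}) is either x itself, in which
-- case any neighbour of x gives a private edge, or adjacent to x, in which case
-- the edge xw is private. Irreflexivity makes the other endpoint lie outside S.

module Submission where

open import Defs
open import Data.Nat using (ℕ; _≤_)
open import Data.Fin.Subset using (Subset; _∈_; _∉_)
open import Data.Product using (_×_; _,_)
open import Data.Sum using (inj₁; inj₂)
open import Relation.Binary.PropositionalEquality using (_≡_; refl; subst)

adjacent-to-sole-member⇒private : (G : Graph) (S : Subset (n G)) {x v : Vertex G} →
  x ∈ S → Adj G x v → (v ∈ S → v ≡ x) → IsPrivateEdge G S x v
adjacent-to-sole-member⇒private G S x∈S x~v v∈S⇒v≡x = x~v , x∈S , v∉S
  where
  v∉S : _ ∉ S
  v∉S v∈S with v∈S⇒v≡x v∈S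
  ... | refl = Graph.irrefl G x~v

DIrSet⇒VCIrSet : (G : Graph) → NoIsolatedVertices G →
  (S : Subset (n G)) → IsDIrSet G S → IsVCIrSet G S
DIrSet⇒VCIrSet G noIsolated S dir x x∈S with dir x x∈S
... | w , inj₂ w~x , private-w =
  w , adjacent-to-sole-member⇒private G S x∈S (Graph.sym G w~x)
        (λ w∈S → private-w w w∈S (inj₁ refl))
... | .x , inj₁ refl , private-x with noIsolated x
...   | u , x~u =
  u , adjacent-to-sole-member⇒private G S x∈S x~u
        (λ u∈S → private-x u u∈S (inj₂ x~u))

IsMaxCard-mono : ∀ {m} {P Q : Subset m → Set} {d c : ℕ} →
  (∀ S → P S → Q S) → IsMaxCard m P d → IsMaxCard m Q c → d ≤ c
IsMaxCard-mono P⇒Q ((S , PS , ∣S∣≡d) , _) (_ , Q-bounded) =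
  subst (_≤ _) ∣S∣≡d (Q-bounded S (P⇒Q S PS))

proposition3p61 : (G : Graph) → NoIsolatedVertices G →
    ((S : Subset (n G)) → IsDIrSet G S → IsVCIrSet G S) ×
    ((d c : ℕ) → IsDIR G d → IsVCIR G c → d ≤ c)
proposition3p61 G noIsolated =
  DIrSet⇒VCIrSet G noIsolated ,
  λ d c → IsMaxCard-mono (DIrSet⇒VCIrSet G noIsolated)
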